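{- Let $s \ge 3$ be an integer and let $H$ be an $s$-uniform hypergraph such that $\left|\bigcup_{e \in F} e\right| \ge (s-1)|F|$ holds for every $F \subseteq E(H)$ with $|F|< 2^{s+1}$. Let $G$ be the $2$-section of $H$. Then for every set $X \subseteq V(G)$ with $|X|=s+1$, the induced subgraph $G[X]$ has at most $\binom{s}{2}+2$ edges.
   Context: A hypergraph is a pair $(V,E)$ with $V$ a finite set and $E \subseteq 2^V\setminus\{\emptyset\}$; it is $s$-uniform if every hyperedge has exactly $s$ elements. The $2$-section of $H$ is the graph on vertex set $V(H)$ in which $uv$ is an edge (for distinct $u,v$) if and only if there is some hyperedge $e$ with $u,v\in e$. $G[X]$ denotes the subgraph of $G$ induced by $X$. -}

module Defs where

open import Data.Nat using (ℕ)
open import Data.Fin using (Fin; _<_; _<?_)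
open import Data.Fin.Subset using (Subset; _∈_; ∣_∣; ⋃)
open import Data.Fin.Subset.Properties using (_∈?_)
open import Data.Fin.Properties using (any?; _≟_)
open import Data.List using (List; filter; map; length; cartesianProduct)
open import Data.Product using (_×_; _,_; ∃; proj₁; proj₂)
open import Data.Product.Properties using () 
open import Relation.Nullary using (¬_; Dec)
open import Relation.Nullary.Decidable using (_×-dec_; ¬?)
open import Relation.Binary.PropositionalEquality using (_≡_)
open import Function.Definitions using (Injective)
open import Data.List using (List) renaming (allFin to allFinL)

record Hypergraph (n : ℕ) : Set where
  field
    m        : ℕ
    edge     : Fin m → Subset n
    edge-inj : Injective _≡_ _≡_ edge
open Hypergraph public

Uniform : ∀ {n} → ℕ → Hypergraph n → Set
Uniform s H = ∀ i → ∣ edge H i ∣ ≡ s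

unionOf : ∀ {n} (H : Hypergraph n) → Subset (m H) → Subset n
unionOf H F = ⋃ (map (edge H) (filter (_∈? F) (allFinL (m H))))

Adj2 : ∀ {n} → Hypergraph n → Fin n → Fin n → Set
Adj2 H u v = (¬ u ≡ v) × ∃ λ i → (u ∈ edge H i) × (v ∈ edge H i)

Adj2? : ∀ {n} (H : Hypergraph n) u v → Dec (Adj2 H u v)
Adj2? H u v = ¬? (u ≟ v) ×-dec any? (λ i → (u ∈? edge H i) ×-dec (v ∈? edge H i))

-- number of edges of the induced subgraph G[X] of the 2-section G of H:
-- unordered pairs counted once as (u , v) with u < v
inducedEdgeCount : ∀ {n} → Hypergraph n → Subset n → ℕ
inducedEdgeCount {n} H X =
  length (filter (λ p → (proj₁ p <? proj₂ p) ×-dec ((proj₁ p ∈? X) ×-dec ((proj₂ p ∈? X) ×-dec Adj2? H (proj₁ p) (proj₂ p))))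
                 (cartesianProduct (allFinL n) (allFinL n)))

-- Write kₑ = |e ∩ X|.  A family F of hyperedges with all kₑ ≥ 2 has |⋃F| ≤ |X| + Σ_{e∈F} (s − kₑ), so when
-- |F| < 2^(s+1) the expansion hypothesis gives Σ_{e∈F} (kₑ − 1) ≤ |X| = s + 1.  Applied to subfamilies of size
-- s + 2 this shows there are at most s + 1 such hyperedges, hence Σₑ (kₑ − 1) ≤ s + 1 over all of E(H).
-- A vertex u ∈ X has at most Σ_{e ∋ u} (kₑ − 1) neighbours in G[X], so 2 e(G[X]) ≤ Σₑ kₑ (kₑ − 1) ≤ K (s + 1)
-- with K = maxₑ kₑ; this suffices unless K = s, or K = s − 1 and s ≥ 5.  In those cases pick e₀ with kₑ₀ = K
-- and split X into A = X ∩ e₀ and O = X ∖ e₀, |O| = s + 1 − K: then 2 e(G[X]) ≤ K (K − 1) + 2 Σ_{w∈O} deg w,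
-- and the degree of each w ∈ O is bounded by the excess Σ_{e ≠ e₀} (kₑ − 1) ≤ s + 2 − K of the other hyperedges.

module Submission where

open import Defs
open import Data.Bool using (true; false)
open import Data.Empty using (⊥-elim)
open import Data.Fin using (Fin; zero; suc; _<?_)
import Data.Fin as Fin
open import Data.Fin.Properties using (_≟_; any?; suc-injective; <-asym)
open import Data.Fin.Subset using (Subset; _∈_; ∣_∣; _∩_; ∁; ⋃; ⊥; _⊆_; Lift)
open import Data.Fin.Subset.Properties
  using (_∈?_; x∈p∩q⁺; x∈p∩q⁻; x∈p∪q⁻; ∉⊥; ∣⊥∣≡0; x∈∁p⇒x∉p; x∉p⇒x∈∁p; Empty-unique; ∣p∩q∣≤∣p∣; ∣p∩q∣≤∣q∣; ∩-comm)
open import Data.List using (List; []; _∷_; _++_; filter; map; length; cartesianProduct; tabulate; allFin)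
open import Data.List.Properties using (map-++; map-∘; map-tabulate)
import Data.List.Membership.Propositional as List
open import Data.List.Membership.Propositional.Properties using (∈-map⁻; ∈-filter⁻)
import Data.List.Relation.Unary.Any as Any
open import Data.Nat using (ℕ; zero; suc; _+_; _*_; _∸_; _^_; _≤_; _<_; z≤n; s≤s; s<s; _≤?_) renaming (_≟_ to _≟ℕ_)
open import Data.Nat.Combinatorics using (_C_; nC1≡n; nCk+nC[k+1]≡[n+1]C[k+1])
import Data.Nat.ListAction as ListSum
import Data.Nat.ListAction.Properties as ListSum
open import Data.Nat.Properties
  using ( +-*-semiring; +-commutativeSemigroup; *-commutativeSemigroup; module ≤-Reasoning
        ; +-assoc; +-identityʳ; +-suc; +-cancelˡ-≡; +-cancelʳ-≤; +-mono-≤; +-monoˡ-≤; +-monoʳ-≤; +-monoʳ-<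
        ; *-comm; *-identityˡ; *-identityʳ; *-zeroʳ; *-distribˡ-+; *-distribʳ-+; *-mono-≤; *-monoˡ-≤; *-monoʳ-≤; *-cancelˡ-≤
        ; +-∸-comm; m+n∸m≡n; m≤n⇒m∸n≡0; ∸-monoˡ-≤; m^n>0
        ; ≤-refl; ≤-reflexive; ≤-trans; ≤-<-trans; <-trans; <-irrefl; ≤-pred; n<1+n; m≤m+n; m≤n+m; ≤∧≢⇒<; ≰⇒>; ≤ᵇ⇒≤ )
open import Data.Nat.Tactic.RingSolver using (solve-∀)
open import Data.Product using (_×_; _,_; proj₁; proj₂; ∃)
open import Data.Sum using (inj₁; inj₂)
open import Data.Unit using (tt)
open import Data.Vec using ([]; _∷_; here; there)
import Data.Vec as Vec
open import Function using (_∘_; id)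
open import Relation.Nullary using (Dec; yes; no; ¬_; does)
open import Relation.Nullary.Decidable using (_×-dec_; ¬?)
open import Relation.Binary.PropositionalEquality using (_≡_; refl; sym; trans; cong; cong₂; subst; module ≡-Reasoning)
open import Algebra.Properties.CommutativeSemigroup +-commutativeSemigroup using (x∙yz≈y∙xz)
open import Algebra.Properties.CommutativeSemigroup *-commutativeSemigroup using () renaming (x∙yz≈y∙xz to x∙yz≈y∙xz*)
open import Algebra.Properties.Semiring.Sum +-*-semiring using (sum; sum-syntax; sum-cong-≗; ∑-distrib-+; ∑-comm; *-distribˡ-sum)

𝟙 : {P : Set} → Dec P → ℕ
𝟙 (yes _) = 1
𝟙 (no _)  = 0

𝟙-yes : {P : Set} (d : Dec P) → P → 𝟙 d ≡ 1
𝟙-yes (yes _) _ = refl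
𝟙-yes (no ¬p) p = ⊥-elim (¬p p)

𝟙-cong : {P Q : Set} (d : Dec P) (e : Dec Q) → (P → Q) → (Q → P) → 𝟙 d ≡ 𝟙 e
𝟙-cong (yes _) (yes _) _   _   = refl
𝟙-cong (yes p) (no ¬q) P→Q _   = ⊥-elim (¬q (P→Q p))
𝟙-cong (no ¬p) (yes q) _   Q→P = ⊥-elim (¬p (Q→P q))
𝟙-cong (no _)  (no _)  _   _   = refl

𝟙-mono : {P Q : Set} (d : Dec P) (e : Dec Q) → (P → Q) → 𝟙 d ≤ 𝟙 e
𝟙-mono (yes _) (yes _) _   = ≤-refl
𝟙-mono (yes p) (no ¬q) P→Q = ⊥-elim (¬q (P→Q p))
𝟙-mono (no _)  _       _   = z≤n

𝟙-× : {P Q : Set} (d : Dec P) (e : Dec Q) → 𝟙 (d ×-dec e) ≡ 𝟙 d * 𝟙 e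
𝟙-× (yes _) (yes _) = refl
𝟙-× (yes _) (no _)  = refl
𝟙-× (no _)  (yes _) = refl
𝟙-× (no _)  (no _)  = refl

𝟙+𝟙¬ : {P : Set} (d : Dec P) → 𝟙 d + 𝟙 (¬? d) ≡ 1
𝟙+𝟙¬ (yes _) = refl
𝟙+𝟙¬ (no _)  = refl

𝟙*-monoʳ-≤ : {P : Set} (d : Dec P) {x y : ℕ} → (P → x ≤ y) → 𝟙 d * x ≤ 𝟙 d * y
𝟙*-monoʳ-≤ (yes p) x≤y = +-monoˡ-≤ 0 (x≤y p)
𝟙*-monoʳ-≤ (no _)  _   = z≤n

sum-mono-≤ : ∀ {n} {f g : Fin n → ℕ} → (∀ i → f i ≤ g i) → sum f ≤ sum g
sum-mono-≤ {zero}  f≤g = z≤n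
sum-mono-≤ {suc n} f≤g = +-mono-≤ (f≤g zero) (sum-mono-≤ (f≤g ∘ suc))

≤-sum : ∀ {n} (f : Fin n → ℕ) i → f i ≤ sum f
≤-sum f zero    = m≤m+n _ _
≤-sum f (suc i) = ≤-trans (≤-sum (λ j → f (suc j)) i) (m≤n+m _ _)

sum-pull : ∀ {n} (f : Fin n → ℕ) i → sum f ≡ f i + ∑[ j < n ] (𝟙 (¬? (j ≟ i)) * f j)
sum-pull f zero = cong (f zero +_) (sum-cong-≗ (λ j → sym (*-identityˡ (f (suc j)))))
sum-pull {suc n} f (suc i) = begin
  f zero + sum (f ∘ suc)                     ≡⟨ cong (f zero +_) (sum-pull (f ∘ suc) i) ⟩
  f zero + (f (suc i) + rest)                ≡⟨ x∙yz≈y∙xz (f zero) (f (suc i)) rest ⟩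
  f (suc i) + (f zero + rest)                ≡⟨ cong (λ t → f (suc i) + (t + rest)) (sym (*-identityˡ (f zero))) ⟩
  f (suc i) + (1 * f zero + rest)            ≡⟨ cong (λ t → f (suc i) + (1 * f zero + t)) (sum-cong-≗ shift) ⟩
  f (suc i) + ∑[ j < suc n ] (𝟙 (¬? (j ≟ suc i)) * f j) ∎
  where
  open ≡-Reasoning
  rest = ∑[ j < n ] (𝟙 (¬? (j ≟ i)) * f (suc j))
  shift : ∀ j → 𝟙 (¬? (j ≟ i)) * f (suc j) ≡ 𝟙 (¬? (suc j ≟ suc i)) * f (suc j)
  shift j = cong (_* f (suc j)) (𝟙-cong (¬? (j ≟ i)) (¬? (suc j ≟ suc i)) (λ j≢i → j≢i ∘ suc-injective) (λ sj≢si → sj≢si ∘ cong suc))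

sum-others : ∀ {n} (f : Fin n → ℕ) i → ∑[ j < n ] (𝟙 (¬? (j ≟ i)) * f j) ≡ sum f ∸ f i
sum-others f i = sym (trans (cong (_∸ f i) (sum-pull f i)) (m+n∸m≡n (f i) _))

length-filter≡sum : ∀ {A : Set} {P : A → Set} (P? : ∀ x → Dec (P x)) xs → length (filter P? xs) ≡ ListSum.sum (map (𝟙 ∘ P?) xs)
length-filter≡sum P? []       = refl
length-filter≡sum P? (x ∷ xs) with P? x
... | yes _ = cong suc (length-filter≡sum P? xs)
... | no _  = length-filter≡sum P? xs

sum-map-cartesianProduct : ∀ {A B : Set} (f : A × B → ℕ) xs (ys : List B) →
  ListSum.sum (map f (cartesianProduct xs ys)) ≡ ListSum.sum (map (λ x → ListSum.sum (map (λ y → f (x , y)) ys)) xs)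
sum-map-cartesianProduct f []       ys = refl
sum-map-cartesianProduct f (x ∷ xs) ys = begin
  ListSum.sum (map f (map (x ,_) ys ++ cartesianProduct xs ys))
    ≡⟨ cong ListSum.sum (map-++ f (map (x ,_) ys) _) ⟩
  ListSum.sum (map f (map (x ,_) ys) ++ map f (cartesianProduct xs ys))
    ≡⟨ ListSum.sum-++ (map f (map (x ,_) ys)) _ ⟩
  ListSum.sum (map f (map (x ,_) ys)) + ListSum.sum (map f (cartesianProduct xs ys))
    ≡⟨ cong₂ _+_ (cong ListSum.sum (sym (map-∘ ys))) (sum-map-cartesianProduct f xs ys) ⟩
  ListSum.sum (map (λ y → f (x , y)) ys) + ListSum.sum (map (λ x → ListSum.sum (map (λ y → f (x , y)) ys)) xs) ∎
  where open ≡-Reasoning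

sum-map-allFin : ∀ {n} (f : Fin n → ℕ) → ListSum.sum (map f (allFin n)) ≡ sum f
sum-map-allFin {zero}  f = refl
sum-map-allFin {suc n} f = cong (f zero +_) (trans (cong ListSum.sum map-f-allFin-suc) (sum-map-allFin (f ∘ suc)))
  where
  map-f-allFin-suc : map f (tabulate suc) ≡ map (f ∘ suc) (allFin n)
  map-f-allFin-suc = trans (map-tabulate suc f) (sym (map-tabulate id (f ∘ suc)))

length-filter-allPairs : ∀ {n} {P : Fin n × Fin n → Set} (P? : ∀ p → Dec (P p)) →
  length (filter P? (cartesianProduct (allFin n) (allFin n))) ≡ ∑[ u < n ] ∑[ v < n ] 𝟙 (P? (u , v))
length-filter-allPairs {n} P? = begin
  length (filter P? (cartesianProduct (allFin n) (allFin n)))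
    ≡⟨ length-filter≡sum P? (cartesianProduct (allFin n) (allFin n)) ⟩
  ListSum.sum (map (𝟙 ∘ P?) (cartesianProduct (allFin n) (allFin n)))
    ≡⟨ sum-map-cartesianProduct (𝟙 ∘ P?) (allFin n) (allFin n) ⟩
  ListSum.sum (map (λ u → ListSum.sum (map (λ v → 𝟙 (P? (u , v))) (allFin n))) (allFin n))
    ≡⟨ sum-map-allFin (λ u → ListSum.sum (map (λ v → 𝟙 (P? (u , v))) (allFin n))) ⟩
  ∑[ u < n ] ListSum.sum (map (λ v → 𝟙 (P? (u , v))) (allFin n))
    ≡⟨ sum-cong-≗ (λ u → sum-map-allFin (λ v → 𝟙 (P? (u , v)))) ⟩
  ∑[ u < n ] ∑[ v < n ] 𝟙 (P? (u , v)) ∎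
  where open ≡-Reasoning

∣p∣≡∑ : ∀ {n} (p : Subset n) → ∣ p ∣ ≡ ∑[ i < n ] 𝟙 (i ∈? p)
∣p∣≡∑ []          = refl
∣p∣≡∑ (true ∷ p)  = cong suc (trans (∣p∣≡∑ p) (sum-cong-≗ (λ i → 𝟙-cong (i ∈? p) (suc i ∈? (true ∷ p)) there (λ { (there i∈p) → i∈p }))))
∣p∣≡∑ (false ∷ p) = trans (∣p∣≡∑ p) (sum-cong-≗ (λ i → 𝟙-cong (i ∈? p) (suc i ∈? (false ∷ p)) there (λ { (there i∈p) → i∈p })))

𝟙-∈∩ : ∀ {n} (p q : Subset n) x → 𝟙 (x ∈? p ∩ q) ≡ 𝟙 (x ∈? p) * 𝟙 (x ∈? q)
𝟙-∈∩ p q x = trans (𝟙-cong (x ∈? p ∩ q) ((x ∈? p) ×-dec (x ∈? q)) (x∈p∩q⁻ p q) x∈p∩q⁺) (𝟙-× (x ∈? p) (x ∈? q))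

𝟙-∈∁ : ∀ {n} (p : Subset n) x → 𝟙 (x ∈? ∁ p) ≡ 𝟙 (¬? (x ∈? p))
𝟙-∈∁ p x = 𝟙-cong (x ∈? ∁ p) (¬? (x ∈? p)) x∈∁p⇒x∉p x∉p⇒x∈∁p

∣p∩q∣≡∑ : ∀ {n} (p q : Subset n) → ∣ p ∩ q ∣ ≡ ∑[ i < n ] (𝟙 (i ∈? p) * 𝟙 (i ∈? q))
∣p∩q∣≡∑ p q = trans (∣p∣≡∑ (p ∩ q)) (sum-cong-≗ (𝟙-∈∩ p q))

𝟙-∈∩+𝟙-∈∩∁ : ∀ {n} (p q : Subset n) x → 𝟙 (x ∈? p ∩ q) + 𝟙 (x ∈? p ∩ ∁ q) ≡ 𝟙 (x ∈? p)
𝟙-∈∩+𝟙-∈∩∁ p q x = begin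
  𝟙 (x ∈? p ∩ q) + 𝟙 (x ∈? p ∩ ∁ q)
    ≡⟨ cong₂ _+_ (𝟙-∈∩ p q x) (trans (𝟙-∈∩ p (∁ q) x) (cong (𝟙 (x ∈? p) *_) (𝟙-∈∁ q x))) ⟩
  𝟙 (x ∈? p) * 𝟙 (x ∈? q) + 𝟙 (x ∈? p) * 𝟙 (¬? (x ∈? q))
    ≡⟨ *-distribˡ-+ (𝟙 (x ∈? p)) _ _ ⟨
  𝟙 (x ∈? p) * (𝟙 (x ∈? q) + 𝟙 (¬? (x ∈? q)))
    ≡⟨ cong (𝟙 (x ∈? p) *_) (𝟙+𝟙¬ (x ∈? q)) ⟩
  𝟙 (x ∈? p) * 1
    ≡⟨ *-identityʳ (𝟙 (x ∈? p)) ⟩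
  𝟙 (x ∈? p) ∎
  where open ≡-Reasoning

∣p∩q∣+∣p∩∁q∣≡∣p∣ : ∀ {n} (p q : Subset n) → ∣ p ∩ q ∣ + ∣ p ∩ ∁ q ∣ ≡ ∣ p ∣
∣p∩q∣+∣p∩∁q∣≡∣p∣ {n} p q = begin
  ∣ p ∩ q ∣ + ∣ p ∩ ∁ q ∣                                    ≡⟨ cong₂ _+_ (∣p∣≡∑ (p ∩ q)) (∣p∣≡∑ (p ∩ ∁ q)) ⟩
  ∑[ x < n ] 𝟙 (x ∈? p ∩ q) + ∑[ x < n ] 𝟙 (x ∈? p ∩ ∁ q)    ≡⟨ ∑-distrib-+ (λ x → 𝟙 (x ∈? p ∩ q)) (λ x → 𝟙 (x ∈? p ∩ ∁ q)) ⟨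
  ∑[ x < n ] (𝟙 (x ∈? p ∩ q) + 𝟙 (x ∈? p ∩ ∁ q))             ≡⟨ sum-cong-≗ (𝟙-∈∩+𝟙-∈∩∁ p q) ⟩
  ∑[ x < n ] 𝟙 (x ∈? p)                                     ≡⟨ ∣p∣≡∑ p ⟨
  ∣ p ∣                                                     ∎
  where open ≡-Reasoning

subset-of-size : ∀ {n} (p : Subset n) {k} → k ≤ ∣ p ∣ → ∃ λ q → q ⊆ p × ∣ q ∣ ≡ k
subset-of-size {n} p {zero} _ = ⊥ , (λ x∈⊥ → ⊥-elim (∉⊥ x∈⊥)) , ∣⊥∣≡0 n
subset-of-size (true ∷ p) {suc k} (s≤s k≤∣p∣) with subset-of-size p k≤∣p∣
... | q , q⊆p , ∣q∣≡k = true ∷ q , (λ { here → here ; (there x∈q) → there (q⊆p x∈q) }) , cong suc ∣q∣≡k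
subset-of-size (false ∷ p) {suc k} k≤∣p∣ with subset-of-size p k≤∣p∣
... | q , q⊆p , ∣q∣≡k = false ∷ q , (λ { (there x∈q) → there (q⊆p x∈q) }) , ∣q∣≡k

subsetOf : ∀ {n} {P : Fin n → Set} → (∀ i → Dec (P i)) → Subset n
subsetOf P? = Vec.tabulate (does ∘ P?)

∈-subsetOf⁻ : ∀ {n} {P : Fin n → Set} (P? : ∀ i → Dec (P i)) {i} → i ∈ subsetOf P? → P i
∈-subsetOf⁻ P? {zero} i∈ with P? zero
∈-subsetOf⁻ P? {zero} here | yes p = p
∈-subsetOf⁻ P? {suc i} (there i∈) = ∈-subsetOf⁻ (P? ∘ suc) i∈

𝟙-subsetOf : ∀ {n} {P : Fin n → Set} (P? : ∀ i → Dec (P i)) i → 𝟙 (i ∈? subsetOf P?) ≡ 𝟙 (P? i)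
𝟙-subsetOf P? i = 𝟙-cong (i ∈? subsetOf P?) (P? i) (∈-subsetOf⁻ P?) (∈-subsetOf⁺ P? i)
  where
  ∈-subsetOf⁺ : ∀ {n} {P : Fin n → Set} (P? : ∀ i → Dec (P i)) i → P i → i ∈ subsetOf P?
  ∈-subsetOf⁺ P? zero p with P? zero
  ... | yes _ = here
  ... | no ¬p = ⊥-elim (¬p p)
  ∈-subsetOf⁺ P? (suc i) p = there (∈-subsetOf⁺ (P? ∘ suc) i p)

∈-⋃⁻ : ∀ {n} (ps : List (Subset n)) {x} → x ∈ ⋃ ps → ∃ λ p → p List.∈ ps × x ∈ p
∈-⋃⁻ []       x∈⋃ = ⊥-elim (∉⊥ x∈⋃)
∈-⋃⁻ (p ∷ ps) x∈⋃ with x∈p∪q⁻ p (⋃ ps) x∈⋃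
... | inj₁ x∈p = p , Any.here refl , x∈p
... | inj₂ x∈⋃ps with ∈-⋃⁻ ps x∈⋃ps
...   | q , q∈ps , x∈q = q , Any.there q∈ps , x∈q

module SimpleGraph {n} {E : Fin n → Fin n → Set} (E? : ∀ u v → Dec (E u v))
                   (E-sym : ∀ {u v} → E u v → E v u) (E-irrefl : ∀ {u} → ¬ E u u) (X : Subset n) where

  adj : Fin n → Fin n → ℕ
  adj u v = 𝟙 (E? u v)

  adj-sym : ∀ u v → adj u v ≡ adj v u
  adj-sym u v = 𝟙-cong (E? u v) (E? v u) E-sym E-sym

  adj≤𝟙≢ : ∀ u v → adj u v ≤ 𝟙 (¬? (v ≟ u))
  adj≤𝟙≢ u v with E? u v
  ... | no _    = z≤n
  ... | yes uEv = ≤-reflexive (sym (𝟙-yes (¬? (v ≟ u)) λ { refl → E-irrefl uEv }))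

  χ : Fin n → ℕ
  χ u = 𝟙 (u ∈? X)

  deg : Fin n → ℕ
  deg u = ∑[ v < n ] (χ v * adj u v)

  inducedPair? : ∀ (p : Fin n × Fin n) → Dec (proj₁ p Fin.< proj₂ p × proj₁ p ∈ X × proj₂ p ∈ X × E (proj₁ p) (proj₂ p))
  inducedPair? (u , v) = (u <? v) ×-dec ((u ∈? X) ×-dec ((v ∈? X) ×-dec E? u v))

  -- For E? = Adj2? H this is inducedEdgeCount H X on the nose.
  edgeCount : ℕ
  edgeCount = length (filter inducedPair? (cartesianProduct (allFin n) (allFin n)))

  handshake : 2 * edgeCount ≤ ∑[ u < n ] (χ u * deg u)
  handshake = begin
    2 * edgeCount                                         ≡⟨ cong (edgeCount +_) (+-identityʳ edgeCount) ⟩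
    edgeCount + edgeCount                                 ≡⟨ cong₂ _+_ edgeCount≡ (trans edgeCount≡ (∑-comm ordered)) ⟩
    ∑[ u < n ] ∑[ v < n ] ordered u v + ∑[ u < n ] ∑[ v < n ] ordered v u
                                                          ≡⟨ ∑-distrib-+ (λ u → ∑[ v < n ] ordered u v) (λ u → ∑[ v < n ] ordered v u) ⟨
    ∑[ u < n ] (∑[ v < n ] ordered u v + ∑[ v < n ] ordered v u)
                                                          ≡⟨ sum-cong-≗ (λ u → ∑-distrib-+ (λ v → ordered u v) (λ v → ordered v u)) ⟨
    ∑[ u < n ] ∑[ v < n ] (ordered u v + ordered v u)     ≤⟨ sum-mono-≤ (λ u → sum-mono-≤ (λ v → ordered+ordered≤edge u v)) ⟩
    ∑[ u < n ] ∑[ v < n ] (χ u * (χ v * adj u v))         ≡⟨ sum-cong-≗ (λ u → *-distribˡ-sum (χ u) (λ v → χ v * adj u v)) ⟨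
    ∑[ u < n ] (χ u * deg u)                              ∎
    where
    open ≤-Reasoning
    ordered : Fin n → Fin n → ℕ
    ordered u v = 𝟙 (u <? v) * (χ u * (χ v * adj u v))
    edgeCount≡ : edgeCount ≡ ∑[ u < n ] ∑[ v < n ] ordered u v
    edgeCount≡ = trans (length-filter-allPairs inducedPair?) (sum-cong-≗ λ u → sum-cong-≗ λ v →
      trans (𝟙-× (u <? v) _) (cong (𝟙 (u <? v) *_) (trans (𝟙-× (u ∈? X) _) (cong (χ u *_) (𝟙-× (v ∈? X) (E? u v))))))
    ordered+ordered≤edge : ∀ u v → ordered u v + ordered v u ≤ χ u * (χ v * adj u v)
    ordered+ordered≤edge u v rewrite x∙yz≈y∙xz* (χ v) (χ u) (adj v u) | adj-sym v u with u <? v | v <? u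
    ... | yes u<v | yes v<u = ⊥-elim (<-asym u<v v<u)
    ... | yes _   | no _    = ≤-reflexive (trans (+-identityʳ _) (+-identityʳ _))
    ... | no _    | yes _   = ≤-reflexive (+-identityʳ _)
    ... | no _    | no _    = z≤n

  within≤ : (A : Subset n) → ∑[ u < n ] ∑[ v < n ] (𝟙 (u ∈? A) * (𝟙 (v ∈? A) * adj u v)) ≤ ∣ A ∣ * (∣ A ∣ ∸ 1)
  within≤ A = begin
    ∑[ u < n ] ∑[ v < n ] (α u * (α v * adj u v))
      ≤⟨ sum-mono-≤ (λ u → sum-mono-≤ λ v →
          *-monoʳ-≤ (α u) (≤-trans (*-monoʳ-≤ (α v) (adj≤𝟙≢ u v)) (≤-reflexive (*-comm (α v) _)))) ⟩
    ∑[ u < n ] ∑[ v < n ] (α u * (𝟙 (¬? (v ≟ u)) * α v))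
      ≡⟨ sum-cong-≗ (λ u → trans (cong (α u *_) (sym (sum-others α u)))
          (*-distribˡ-sum (α u) (λ v → 𝟙 (¬? (v ≟ u)) * α v))) ⟨
    ∑[ u < n ] (α u * (sum α ∸ α u))
      ≤⟨ sum-mono-≤ (λ u → 𝟙*-monoʳ-≤ (u ∈? A) (λ u∈A → ≤-reflexive (cong (sum α ∸_) (𝟙-yes (u ∈? A) u∈A)))) ⟩
    ∑[ u < n ] (α u * (sum α ∸ 1))
      ≡⟨ sum-cong-≗ (λ u → *-comm (α u) (sum α ∸ 1)) ⟩
    ∑[ u < n ] ((sum α ∸ 1) * α u)
      ≡⟨ *-distribˡ-sum (sum α ∸ 1) α ⟨
    (sum α ∸ 1) * sum α
      ≡⟨ cong (λ a → (a ∸ 1) * a) (∣p∣≡∑ A) ⟨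
    (∣ A ∣ ∸ 1) * ∣ A ∣
      ≡⟨ *-comm (∣ A ∣ ∸ 1) ∣ A ∣ ⟩
    ∣ A ∣ * (∣ A ∣ ∸ 1) ∎
    where
    open ≤-Reasoning
    α : Fin n → ℕ
    α u = 𝟙 (u ∈? A)

  across≤ : (A O : Subset n) → A ⊆ X →
            ∑[ u < n ] ∑[ v < n ] (𝟙 (u ∈? A) * (𝟙 (v ∈? O) * adj u v)) ≤ ∑[ v < n ] (𝟙 (v ∈? O) * deg v)
  across≤ A O A⊆X = begin
    ∑[ u < n ] ∑[ v < n ] (𝟙 (u ∈? A) * (ω v * adj u v))  ≤⟨ sum-mono-≤ (λ u → sum-mono-≤ λ v → reorder u v) ⟩
    ∑[ u < n ] ∑[ v < n ] (ω v * (χ u * adj v u))         ≡⟨ ∑-comm (λ u v → ω v * (χ u * adj v u)) ⟩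
    ∑[ v < n ] ∑[ u < n ] (ω v * (χ u * adj v u))         ≡⟨ sum-cong-≗ (λ v → *-distribˡ-sum (ω v) (λ u → χ u * adj v u)) ⟨
    ∑[ v < n ] (ω v * deg v)                              ∎
    where
    open ≤-Reasoning
    ω : Fin n → ℕ
    ω v = 𝟙 (v ∈? O)
    reorder : ∀ u v → 𝟙 (u ∈? A) * (ω v * adj u v) ≤ ω v * (χ u * adj v u)
    reorder u v = begin
      𝟙 (u ∈? A) * (ω v * adj u v)   ≡⟨ x∙yz≈y∙xz* (𝟙 (u ∈? A)) (ω v) (adj u v) ⟩
      ω v * (𝟙 (u ∈? A) * adj u v)   ≤⟨ *-monoʳ-≤ (ω v) (*-mono-≤ (𝟙-mono (u ∈? A) (u ∈? X) A⊆X) (≤-reflexive (adj-sym u v))) ⟩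
      ω v * (χ u * adj v u)          ∎

  degreeSum-split : (B : Subset n) →
    ∑[ u < n ] (χ u * deg u) ≤ ∣ X ∩ B ∣ * (∣ X ∩ B ∣ ∸ 1) + 2 * ∑[ u < n ] (𝟙 (u ∈? X ∩ ∁ B) * deg u)
  degreeSum-split B = begin
    ∑[ u < n ] (χ u * deg u)
      ≡⟨ sum-cong-≗ (λ u → trans (cong (_* deg u) (χ≡α+ω u)) (*-distribʳ-+ (deg u) (α u) (ω u))) ⟩
    ∑[ u < n ] (α u * deg u + ω u * deg u)
      ≡⟨ ∑-distrib-+ (λ u → α u * deg u) (λ u → ω u * deg u) ⟩
    ∑[ u < n ] (α u * deg u) + degO
      ≡⟨ cong (_+ degO) (sum-cong-≗ (λ u → trans (*-distribˡ-sum (α u) (λ v → χ v * adj u v)) (sum-cong-≗ (split u)))) ⟩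
    ∑[ u < n ] ∑[ v < n ] (α u * (α v * adj u v) + α u * (ω v * adj u v)) + degO
      ≡⟨ cong (_+ degO) (trans (sum-cong-≗ (λ u → ∑-distrib-+ (λ v → α u * (α v * adj u v)) (λ v → α u * (ω v * adj u v))))
          (∑-distrib-+ (λ u → ∑[ v < n ] (α u * (α v * adj u v))) (λ u → ∑[ v < n ] (α u * (ω v * adj u v))))) ⟩
    ∑[ u < n ] ∑[ v < n ] (α u * (α v * adj u v)) + ∑[ u < n ] ∑[ v < n ] (α u * (ω v * adj u v)) + degO
      ≤⟨ +-monoˡ-≤ degO (+-mono-≤ (within≤ A) (across≤ A O (proj₁ ∘ x∈p∩q⁻ X B))) ⟩
    ∣ A ∣ * (∣ A ∣ ∸ 1) + degO + degO
      ≡⟨ +-assoc (∣ A ∣ * (∣ A ∣ ∸ 1)) degO degO ⟩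
    ∣ A ∣ * (∣ A ∣ ∸ 1) + (degO + degO)
      ≡⟨ cong (λ d → ∣ A ∣ * (∣ A ∣ ∸ 1) + (degO + d)) (+-identityʳ degO) ⟨
    ∣ A ∣ * (∣ A ∣ ∸ 1) + 2 * degO ∎
    where
    open ≤-Reasoning
    A O : Subset n
    A = X ∩ B
    O = X ∩ ∁ B
    α ω : Fin n → ℕ
    α u = 𝟙 (u ∈? A)
    ω u = 𝟙 (u ∈? O)
    degO = ∑[ u < n ] (ω u * deg u)
    χ≡α+ω : ∀ u → χ u ≡ α u + ω u
    χ≡α+ω u = sym (𝟙-∈∩+𝟙-∈∩∁ X B u)
    split : ∀ u v → α u * (χ v * adj u v) ≡ α u * (α v * adj u v) + α u * (ω v * adj u v)
    split u v = trans (cong (λ c → α u * (c * adj u v)) (χ≡α+ω v))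
                      (trans (cong (α u *_) (*-distribʳ-+ (adj u v) (α v) (ω v))) (*-distribˡ-+ (α u) _ _))

∈-unionOf⁻ : ∀ {n} (H : Hypergraph n) (F : Subset (m H)) {v} → v ∈ unionOf H F → ∃ λ i → i ∈ F × v ∈ edge H i
∈-unionOf⁻ H F v∈ with ∈-⋃⁻ (map (edge H) (filter (_∈? F) (allFin (m H)))) v∈
... | e , e∈ , v∈e with ∈-map⁻ (edge H) e∈
...   | i , i∈ , refl = i , proj₂ (∈-filter⁻ (_∈? F) {xs = allFin (m H)} i∈) , v∈e

∣unionOf∣≤ : ∀ {n} (H : Hypergraph n) (F : Subset (m H)) (X : Subset n) →
             ∣ unionOf H F ∣ ≤ ∣ X ∣ + ∑[ i < m H ] (𝟙 (i ∈? F) * ∣ edge H i ∩ ∁ X ∣)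
∣unionOf∣≤ {n} H F X = begin
  ∣ unionOf H F ∣
    ≡⟨ ∣p∣≡∑ (unionOf H F) ⟩
  ∑[ v < n ] 𝟙 (v ∈? unionOf H F)
    ≤⟨ sum-mono-≤ covered ⟩
  ∑[ v < n ] (𝟙 (v ∈? X) + ∑[ i < m H ] (𝟙 (i ∈? F) * 𝟙 (v ∈? edge H i ∩ ∁ X)))
    ≡⟨ ∑-distrib-+ (λ v → 𝟙 (v ∈? X)) (λ v → ∑[ i < m H ] (𝟙 (i ∈? F) * 𝟙 (v ∈? edge H i ∩ ∁ X))) ⟩
  ∑[ v < n ] 𝟙 (v ∈? X) + ∑[ v < n ] ∑[ i < m H ] (𝟙 (i ∈? F) * 𝟙 (v ∈? edge H i ∩ ∁ X))
    ≡⟨ cong₂ _+_ (sym (∣p∣≡∑ X)) (∑-comm (λ v i → 𝟙 (i ∈? F) * 𝟙 (v ∈? edge H i ∩ ∁ X))) ⟩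
  ∣ X ∣ + ∑[ i < m H ] ∑[ v < n ] (𝟙 (i ∈? F) * 𝟙 (v ∈? edge H i ∩ ∁ X))
    ≡⟨ cong (∣ X ∣ +_) (sum-cong-≗ λ i →
        trans (cong (𝟙 (i ∈? F) *_) (∣p∣≡∑ (edge H i ∩ ∁ X))) (*-distribˡ-sum (𝟙 (i ∈? F)) (λ v → 𝟙 (v ∈? edge H i ∩ ∁ X)))) ⟨
  ∣ X ∣ + ∑[ i < m H ] (𝟙 (i ∈? F) * ∣ edge H i ∩ ∁ X ∣) ∎
  where
  open ≤-Reasoning
  covered : ∀ v → 𝟙 (v ∈? unionOf H F) ≤ 𝟙 (v ∈? X) + ∑[ i < m H ] (𝟙 (i ∈? F) * 𝟙 (v ∈? edge H i ∩ ∁ X))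
  covered v with v ∈? unionOf H F
  ... | no _ = z≤n
  ... | yes v∈⋃ with ∈-unionOf⁻ H F v∈⋃ | v ∈? X
  ...   | _ | yes _ = s≤s z≤n
  ...   | i , i∈F , v∈e | no v∉X = ≤-trans (≤-reflexive (sym witness)) (≤-sum (λ j → 𝟙 (j ∈? F) * 𝟙 (v ∈? edge H j ∩ ∁ X)) i)
    where
    witness : 𝟙 (i ∈? F) * 𝟙 (v ∈? edge H i ∩ ∁ X) ≡ 1
    witness rewrite 𝟙-yes (i ∈? F) i∈F | 𝟙-yes (v ∈? edge H i ∩ ∁ X) (x∈p∩q⁺ (v∈e , x∉p⇒x∈∁p v∉X)) = refl

Adj2-sym : ∀ {n} (H : Hypergraph n) {u v} → Adj2 H u v → Adj2 H v u
Adj2-sym H (u≢v , i , u∈e , v∈e) = u≢v ∘ sym , i , v∈e , u∈e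

Adj2-irrefl : ∀ {n} (H : Hypergraph n) {u} → ¬ Adj2 H u u
Adj2-irrefl H (u≢u , _) = u≢u refl

module Trace {n} (H : Hypergraph n) (X : Subset n) where

  open SimpleGraph (Adj2? H) (Adj2-sym H) (Adj2-irrefl H) X public

  k : Fin (m H) → ℕ
  k i = ∣ edge H i ∩ X ∣

  deg≤∑k∸1 : ∀ {u} → u ∈ X → deg u ≤ ∑[ i < m H ] (𝟙 (u ∈? edge H i) * (k i ∸ 1))
  deg≤∑k∸1 {u} u∈X = begin
    ∑[ v < n ] (χ v * adj u v)
      ≤⟨ sum-mono-≤ neighbour≤ ⟩
    ∑[ v < n ] ∑[ i < m H ] (𝟙 (u ∈? edge H i) * (𝟙 (¬? (v ≟ u)) * g i v))
      ≡⟨ ∑-comm (λ v i → 𝟙 (u ∈? edge H i) * (𝟙 (¬? (v ≟ u)) * g i v)) ⟩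
    ∑[ i < m H ] ∑[ v < n ] (𝟙 (u ∈? edge H i) * (𝟙 (¬? (v ≟ u)) * g i v))
      ≡⟨ sum-cong-≗ (λ i → trans (cong (𝟙 (u ∈? edge H i) *_) (sym (sum-others (g i) u)))
          (*-distribˡ-sum (𝟙 (u ∈? edge H i)) (λ v → 𝟙 (¬? (v ≟ u)) * g i v))) ⟨
    ∑[ i < m H ] (𝟙 (u ∈? edge H i) * (sum (g i) ∸ g i u))
      ≤⟨ sum-mono-≤ (λ i → 𝟙*-monoʳ-≤ (u ∈? edge H i) (λ u∈e → ≤-reflexive (
          cong₂ _∸_ (sym (∣p∩q∣≡∑ (edge H i) X)) (cong₂ _*_ (𝟙-yes (u ∈? edge H i) u∈e) (𝟙-yes (u ∈? X) u∈X))))) ⟩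
    ∑[ i < m H ] (𝟙 (u ∈? edge H i) * (k i ∸ 1)) ∎
    where
    open ≤-Reasoning
    g : Fin (m H) → Fin n → ℕ
    g i v = 𝟙 (v ∈? edge H i) * χ v
    neighbour≤ : ∀ v → χ v * adj u v ≤ ∑[ i < m H ] (𝟙 (u ∈? edge H i) * (𝟙 (¬? (v ≟ u)) * g i v))
    neighbour≤ v with v ∈? X | Adj2? H u v
    ... | no _    | _    = z≤n
    ... | yes _   | no _ = z≤n
    ... | yes v∈X | yes (u≢v , i , u∈e , v∈e) = ≤-trans (≤-reflexive (sym shared-edge)) (≤-sum _ i)
      where
      shared-edge : 𝟙 (u ∈? edge H i) * (𝟙 (¬? (v ≟ u)) * (𝟙 (v ∈? edge H i) * 1)) ≡ 1
      shared-edge rewrite 𝟙-yes (u ∈? edge H i) u∈e | 𝟙-yes (¬? (v ≟ u)) (u≢v ∘ sym) | 𝟙-yes (v ∈? edge H i) v∈e = refl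

  degreeSum≤ : (Y : Subset n) → Y ⊆ X → ∑[ u < n ] (𝟙 (u ∈? Y) * deg u) ≤ ∑[ i < m H ] ((k i ∸ 1) * ∣ edge H i ∩ Y ∣)
  degreeSum≤ Y Y⊆X = begin
    ∑[ u < n ] (𝟙 (u ∈? Y) * deg u)
      ≤⟨ sum-mono-≤ (λ u → 𝟙*-monoʳ-≤ (u ∈? Y) (deg≤∑k∸1 ∘ Y⊆X)) ⟩
    ∑[ u < n ] (𝟙 (u ∈? Y) * ∑[ i < m H ] (𝟙 (u ∈? edge H i) * (k i ∸ 1)))
      ≡⟨ sum-cong-≗ (λ u → *-distribˡ-sum (𝟙 (u ∈? Y)) (λ i → 𝟙 (u ∈? edge H i) * (k i ∸ 1))) ⟩
    ∑[ u < n ] ∑[ i < m H ] (𝟙 (u ∈? Y) * (𝟙 (u ∈? edge H i) * (k i ∸ 1)))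
      ≡⟨ ∑-comm (λ u i → 𝟙 (u ∈? Y) * (𝟙 (u ∈? edge H i) * (k i ∸ 1))) ⟩
    ∑[ i < m H ] ∑[ u < n ] (𝟙 (u ∈? Y) * (𝟙 (u ∈? edge H i) * (k i ∸ 1)))
      ≡⟨ sum-cong-≗ (λ i → sum-cong-≗ (λ u → reassoc (𝟙 (u ∈? Y)) (𝟙 (u ∈? edge H i)) (k i ∸ 1))) ⟩
    ∑[ i < m H ] ∑[ u < n ] ((k i ∸ 1) * (𝟙 (u ∈? edge H i) * 𝟙 (u ∈? Y)))
      ≡⟨ sum-cong-≗ (λ i → trans (cong ((k i ∸ 1) *_) (∣p∩q∣≡∑ (edge H i) Y))
          (*-distribˡ-sum (k i ∸ 1) (λ u → 𝟙 (u ∈? edge H i) * 𝟙 (u ∈? Y)))) ⟨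
    ∑[ i < m H ] ((k i ∸ 1) * ∣ edge H i ∩ Y ∣) ∎
    where
    open ≤-Reasoning
    reassoc : ∀ a b c → a * (b * c) ≡ c * (b * a)
    reassoc = solve-∀

  degreeSum≤-uniform : ∀ {K E} → (∀ i → k i ≤ K) → ∑[ i < m H ] (k i ∸ 1) ≤ E → ∑[ u < n ] (χ u * deg u) ≤ K * E
  degreeSum≤-uniform {K} {E} k≤K excess≤E = begin
    ∑[ u < n ] (χ u * deg u)
      ≤⟨ degreeSum≤ X (λ u∈X → u∈X) ⟩
    ∑[ i < m H ] ((k i ∸ 1) * k i)
      ≤⟨ sum-mono-≤ (λ i → ≤-trans (≤-reflexive (*-comm (k i ∸ 1) (k i))) (*-monoˡ-≤ (k i ∸ 1) (k≤K i))) ⟩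
    ∑[ i < m H ] (K * (k i ∸ 1))
      ≡⟨ *-distribˡ-sum K (λ i → k i ∸ 1) ⟨
    K * ∑[ i < m H ] (k i ∸ 1)
      ≤⟨ *-monoʳ-≤ K excess≤E ⟩
    K * E ∎
    where open ≤-Reasoning

  degreeSum≤-around : ∀ i₀ {κ j T} → k i₀ ≡ κ → κ + j ≡ ∣ X ∣ → ∑[ i < m H ] (k i ∸ 1) ≤ (κ ∸ 1) + T →
                      ∑[ u < n ] (χ u * deg u) ≤ κ * (κ ∸ 1) + 2 * (j * T)
  degreeSum≤-around i₀ {j = j} {T} refl k+j≡∣X∣ excess≤ = begin
    ∑[ u < n ] (χ u * deg u)                                 ≤⟨ degreeSum-split e₀ ⟩
    ∣ A ∣ * (∣ A ∣ ∸ 1) + 2 * ∑[ u < n ] (𝟙 (u ∈? O) * deg u)  ≡⟨ cong (λ a → a * (a ∸ 1) + 2 * ∑[ u < n ] (𝟙 (u ∈? O) * deg u)) ∣A∣≡k ⟩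
    k i₀ * (k i₀ ∸ 1) + 2 * ∑[ u < n ] (𝟙 (u ∈? O) * deg u)   ≤⟨ +-monoʳ-≤ (k i₀ * (k i₀ ∸ 1)) (*-monoʳ-≤ 2 outside≤) ⟩
    k i₀ * (k i₀ ∸ 1) + 2 * (j * T)                           ∎
    where
    open ≤-Reasoning
    e₀ = edge H i₀
    A = X ∩ e₀
    O = X ∩ ∁ e₀
    ∣A∣≡k : ∣ A ∣ ≡ k i₀
    ∣A∣≡k = cong ∣_∣ (∩-comm X e₀)
    ∣O∣≡j : ∣ O ∣ ≡ j
    ∣O∣≡j = +-cancelˡ-≡ (k i₀) ∣ O ∣ j (trans (cong (_+ ∣ O ∣) (sym ∣A∣≡k)) (trans (∣p∩q∣+∣p∩∁q∣≡∣p∣ X e₀) (sym k+j≡∣X∣)))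
    ∣e₀∩O∣≡0 : ∣ e₀ ∩ O ∣ ≡ 0
    ∣e₀∩O∣≡0 = trans (cong ∣_∣ (Empty-unique λ (x , x∈e₀∩O) →
                      let (x∈e₀ , x∈O) = x∈p∩q⁻ e₀ O x∈e₀∩O in x∈∁p⇒x∉p (proj₂ (x∈p∩q⁻ X (∁ e₀) x∈O)) x∈e₀))
                     (∣⊥∣≡0 n)
    term≤ : ∀ i → (k i ∸ 1) * ∣ edge H i ∩ O ∣ ≤ j * (𝟙 (¬? (i ≟ i₀)) * (k i ∸ 1))
    term≤ i with i ≟ i₀
    ... | yes refl rewrite ∣e₀∩O∣≡0 | *-zeroʳ (k i₀ ∸ 1) = z≤n
    ... | no _ = begin
      (k i ∸ 1) * ∣ edge H i ∩ O ∣   ≤⟨ *-monoʳ-≤ (k i ∸ 1) (≤-trans (∣p∩q∣≤∣q∣ (edge H i) O) (≤-reflexive ∣O∣≡j)) ⟩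
      (k i ∸ 1) * j                  ≡⟨ *-comm (k i ∸ 1) j ⟩
      j * (k i ∸ 1)                  ≡⟨ cong (j *_) (*-identityˡ (k i ∸ 1)) ⟨
      j * (1 * (k i ∸ 1))            ∎
    outside≤ : ∑[ u < n ] (𝟙 (u ∈? O) * deg u) ≤ j * T
    outside≤ = begin
      ∑[ u < n ] (𝟙 (u ∈? O) * deg u)
        ≤⟨ degreeSum≤ O (proj₁ ∘ x∈p∩q⁻ X (∁ e₀)) ⟩
      ∑[ i < m H ] ((k i ∸ 1) * ∣ edge H i ∩ O ∣)
        ≤⟨ sum-mono-≤ term≤ ⟩
      ∑[ i < m H ] (j * (𝟙 (¬? (i ≟ i₀)) * (k i ∸ 1)))
        ≡⟨ *-distribˡ-sum j (λ i → 𝟙 (¬? (i ≟ i₀)) * (k i ∸ 1)) ⟨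
      j * ∑[ i < m H ] (𝟙 (¬? (i ≟ i₀)) * (k i ∸ 1))
        ≡⟨ cong (j *_) (sum-others (λ i → k i ∸ 1) i₀) ⟩
      j * (∑[ i < m H ] (k i ∸ 1) ∸ (k i₀ ∸ 1))
        ≤⟨ *-monoʳ-≤ j (≤-trans (∸-monoˡ-≤ (k i₀ ∸ 1) excess≤) (≤-reflexive (m+n∸m≡n (k i₀ ∸ 1) T))) ⟩
      j * T ∎

n+2<2^[n+1] : ∀ {n} → 1 ≤ n → n + 2 < 2 ^ (n + 1)
n+2<2^[n+1] {suc zero}    _ = ≤-refl
n+2<2^[n+1] {suc (suc n)} _ = begin-strict
  suc (suc n + 2)   <⟨ s<s (n+2<2^[n+1] {suc n} (s≤s z≤n)) ⟩
  suc x             ≤⟨ +-monoˡ-≤ x (m^n>0 2 (suc n + 1)) ⟩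
  x + x             ≡⟨ cong (x +_) (+-identityʳ x) ⟨
  2 * x             ∎
  where
  open ≤-Reasoning
  x = 2 ^ (suc n + 1)

module Excess {n} (s : ℕ) (1≤s : 1 ≤ s) (H : Hypergraph n) (uniform : Uniform s H)
              (small-unions : (F : Subset (m H)) → ∣ F ∣ < 2 ^ (s + 1) → (s ∸ 1) * ∣ F ∣ ≤ ∣ unionOf H F ∣)
              (X : Subset n) (∣X∣≡s+1 : ∣ X ∣ ≡ s + 1) where

  open Trace H X using (k)

  Crowded : Fin (m H) → Set
  Crowded i = 2 ≤ k i

  k∸1+∣e∖X∣≡s∸1 : ∀ i → 1 ≤ k i → (k i ∸ 1) + ∣ edge H i ∩ ∁ X ∣ ≡ s ∸ 1
  k∸1+∣e∖X∣≡s∸1 i 1≤k = begin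
    (k i ∸ 1) + ∣ edge H i ∩ ∁ X ∣   ≡⟨ +-∸-comm ∣ edge H i ∩ ∁ X ∣ 1≤k ⟨
    k i + ∣ edge H i ∩ ∁ X ∣ ∸ 1     ≡⟨ cong (_∸ 1) (trans (∣p∩q∣+∣p∩∁q∣≡∣p∣ (edge H i) X) (uniform i)) ⟩
    s ∸ 1                           ∎
    where open ≡-Reasoning

  excess≤-small : (F : Subset (m H)) → Lift Crowded F → ∣ F ∣ < 2 ^ (s + 1) →
                  ∑[ i < m H ] (𝟙 (i ∈? F) * (k i ∸ 1)) ≤ s + 1
  excess≤-small F crowded ∣F∣<2^[s+1] = +-cancelʳ-≤ outside excess (s + 1) (begin
    excess + outside                                                 ≡⟨ ∑-distrib-+ (λ i → 𝟙 (i ∈? F) * (k i ∸ 1)) _ ⟨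
    ∑[ i < m H ] (𝟙 (i ∈? F) * (k i ∸ 1) + 𝟙 (i ∈? F) * ∣ edge H i ∩ ∁ X ∣)
                                                                     ≡⟨ sum-cong-≗ term≡ ⟩
    ∑[ i < m H ] ((s ∸ 1) * 𝟙 (i ∈? F))                              ≡⟨ *-distribˡ-sum (s ∸ 1) (λ i → 𝟙 (i ∈? F)) ⟨
    (s ∸ 1) * ∑[ i < m H ] 𝟙 (i ∈? F)                                ≡⟨ cong ((s ∸ 1) *_) (∣p∣≡∑ F) ⟨
    (s ∸ 1) * ∣ F ∣                                                  ≤⟨ small-unions F ∣F∣<2^[s+1] ⟩
    ∣ unionOf H F ∣                                                  ≤⟨ ∣unionOf∣≤ H F X ⟩
    ∣ X ∣ + outside                                                  ≡⟨ cong (_+ outside) ∣X∣≡s+1 ⟩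
    s + 1 + outside                                                  ∎)
    where
    open ≤-Reasoning
    excess outside : ℕ
    excess  = ∑[ i < m H ] (𝟙 (i ∈? F) * (k i ∸ 1))
    outside = ∑[ i < m H ] (𝟙 (i ∈? F) * ∣ edge H i ∩ ∁ X ∣)
    term≡ : ∀ i → 𝟙 (i ∈? F) * (k i ∸ 1) + 𝟙 (i ∈? F) * ∣ edge H i ∩ ∁ X ∣ ≡ (s ∸ 1) * 𝟙 (i ∈? F)
    term≡ i with i ∈? F
    ... | no _    = sym (*-zeroʳ (s ∸ 1))
    ... | yes i∈F = trans (cong₂ _+_ (+-identityʳ (k i ∸ 1)) (+-identityʳ _))
                          (trans (k∸1+∣e∖X∣≡s∸1 i (≤-trans (s≤s z≤n) (crowded i∈F))) (sym (*-identityʳ (s ∸ 1))))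

  -- A crowded subfamily of size s + 2 is small enough for the hypothesis, yet its excess would be at least s + 2.
  crowded-family-size : (F : Subset (m H)) → Lift Crowded F → ∣ F ∣ ≤ s + 1
  crowded-family-size F crowded with ∣ F ∣ ≤? s + 1
  ... | yes ∣F∣≤s+1 = ∣F∣≤s+1
  ... | no ∣F∣≰s+1 with subset-of-size F (≰⇒> ∣F∣≰s+1)
  ...   | G , G⊆F , ∣G∣≡s+2 = ⊥-elim (<-irrefl refl (begin-strict
    s + 1                                   <⟨ n<1+n (s + 1) ⟩
    suc (s + 1)                             ≡⟨ trans (sym ∣G∣≡s+2) (∣p∣≡∑ G) ⟩
    ∑[ i < m H ] 𝟙 (i ∈? G)                 ≤⟨ sum-mono-≤ (λ i → ≤-trans (≤-reflexive (sym (*-identityʳ _)))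
                                                 (𝟙*-monoʳ-≤ (i ∈? G) (λ i∈G → ∸-monoˡ-≤ 1 (crowded (G⊆F i∈G))))) ⟩
    ∑[ i < m H ] (𝟙 (i ∈? G) * (k i ∸ 1))   ≤⟨ excess≤-small G (crowded ∘ G⊆F) ∣G∣<2^[s+1] ⟩
    s + 1                                   ∎))
    where
    open ≤-Reasoning
    ∣G∣<2^[s+1] : ∣ G ∣ < 2 ^ (s + 1)
    ∣G∣<2^[s+1] = subst (_< 2 ^ (s + 1)) (trans (+-suc s 1) (sym ∣G∣≡s+2)) (n+2<2^[n+1] 1≤s)

  -- Truncated subtraction makes k i ∸ 1 vanish on hyperedges meeting X at most once, so only crowded ones count.
  excess≤ : ∑[ i < m H ] (k i ∸ 1) ≤ s + 1
  excess≤ = begin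
    ∑[ i < m H ] (k i ∸ 1)
      ≡⟨ sum-cong-≗ only-crowded ⟩
    ∑[ i < m H ] (𝟙 (i ∈? F₂) * (k i ∸ 1))
      ≤⟨ excess≤-small F₂ (∈-subsetOf⁻ Crowded?) (≤-<-trans (crowded-family-size F₂ (∈-subsetOf⁻ Crowded?)) s+1<2^[s+1]) ⟩
    s + 1 ∎
    where
    open ≤-Reasoning
    Crowded? : ∀ i → Dec (Crowded i)
    Crowded? i = 2 ≤? k i
    F₂ = subsetOf Crowded?
    s+1<2^[s+1] : s + 1 < 2 ^ (s + 1)
    s+1<2^[s+1] = <-trans (+-monoʳ-< s ≤-refl) (n+2<2^[n+1] 1≤s)
    only-crowded : ∀ i → k i ∸ 1 ≡ 𝟙 (i ∈? F₂) * (k i ∸ 1)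
    only-crowded i rewrite 𝟙-subsetOf Crowded? i with Crowded? i
    ... | yes _ = sym (+-identityʳ (k i ∸ 1))
    ... | no k≱2 = m≤n⇒m∸n≡0 (≤-pred (≰⇒> k≱2))

2*nC2≡n*[n∸1] : ∀ n → 2 * (n C 2) ≡ n * (n ∸ 1)
2*nC2≡n*[n∸1] zero          = refl
2*nC2≡n*[n∸1] (suc zero)    = refl
2*nC2≡n*[n∸1] (suc (suc n)) = begin
  2 * (suc (suc n) C 2)          ≡⟨ cong (2 *_) (nCk+nC[k+1]≡[n+1]C[k+1] (suc n) 1) ⟨
  2 * (suc n C 1 + suc n C 2)    ≡⟨ cong (λ c → 2 * (c + suc n C 2)) (nC1≡n (suc n)) ⟩
  2 * (suc n + suc n C 2)        ≡⟨ *-distribˡ-+ 2 (suc n) (suc n C 2) ⟩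
  2 * suc n + 2 * (suc n C 2)    ≡⟨ cong (2 * suc n +_) (2*nC2≡n*[n∸1] (suc n)) ⟩
  2 * suc n + suc n * n          ≡⟨ pascal n ⟩
  suc (suc n) * suc n            ∎
  where
  open ≡-Reasoning
  pascal : ∀ n → 2 * suc n + suc n * n ≡ suc (suc n) * suc n
  pascal = solve-∀

s∸1+2≡s+1 : ∀ t → (2 + t) + 2 ≡ 3 + t + 1
s∸1+2≡s+1 t = cong (λ x → suc (suc x)) (+-suc t 1)

s∸2+3≡s+1 : ∀ t → (1 + t) + 3 ≡ 3 + t + 1
s∸2+3≡s+1 t = cong suc (trans (+-suc t 2) (cong suc (+-suc t 1)))

[s∸1][s+1]≤s[s∸1]+4 : ∀ {t} → t ≤ 1 → (2 + t) * (3 + t + 1) ≤ (3 + t) * (2 + t) + 4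
[s∸1][s+1]≤s[s∸1]+4 z≤n       = ≤ᵇ⇒≤ _ _ tt
[s∸1][s+1]≤s[s∸1]+4 (s≤s z≤n) = ≤ᵇ⇒≤ _ _ tt

[s∸1][s∸2]+12≤s[s∸1]+4 : ∀ {t} → 2 ≤ t → (2 + t) * (1 + t) + 2 * (2 * 3) ≤ (3 + t) * (2 + t) + 4
[s∸1][s∸2]+12≤s[s∸1]+4 {suc zero}    (s≤s ())
[s∸1][s∸2]+12≤s[s∸1]+4 {suc (suc r)} _ = ≤-trans (m≤m+n _ (2 * r)) (≤-reflexive (identity r))
  where
  identity : ∀ r → (4 + r) * (3 + r) + 2 * (2 * 3) + 2 * r ≡ (5 + r) * (4 + r) + 4
  identity = solve-∀

[s∸2][s+1]≤s[s∸1]+4 : ∀ t → (1 + t) * (3 + t + 1) ≤ (3 + t) * (2 + t) + 4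
[s∸2][s+1]≤s[s∸1]+4 t = ≤-trans (m≤m+n _ 6) (≤-reflexive (identity t))
  where
  identity : ∀ t → (1 + t) * (3 + t + 1) + 6 ≡ (3 + t) * (2 + t) + 4
  identity = solve-∀

module _ {n} (t : ℕ) (H : Hypergraph n) (uniform : Uniform (3 + t) H) (X : Subset n) (∣X∣≡s+1 : ∣ X ∣ ≡ 3 + t + 1) where

  open Trace H X

  k≤s : ∀ i → k i ≤ 3 + t
  k≤s i = ≤-trans (∣p∩q∣≤∣p∣ (edge H i) X) (≤-reflexive (uniform i))

  degreeSum≤s[s∸1]+4 : ∑[ i < m H ] (k i ∸ 1) ≤ 3 + t + 1 → ∑[ u < n ] (χ u * deg u) ≤ (3 + t) * (2 + t) + 4
  degreeSum≤s[s∸1]+4 excess≤ with any? (λ i → k i ≟ℕ 3 + t)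
  ... | yes (i₀ , k≡s) = degreeSum≤-around i₀ k≡s (sym ∣X∣≡s+1) (≤-trans excess≤ (≤-reflexive (sym (s∸1+2≡s+1 t))))
  ... | no no-edge-of-size-s with t ≤? 1
  ...   | yes t≤1 = ≤-trans (degreeSum≤-uniform k≤s∸1 excess≤) ([s∸1][s+1]≤s[s∸1]+4 t≤1)
    where
    k≤s∸1 : ∀ i → k i ≤ 2 + t
    k≤s∸1 i = ≤-pred (≤∧≢⇒< (k≤s i) (no-edge-of-size-s ∘ (i ,_)))
  ...   | no t≰1 with any? (λ i → k i ≟ℕ 2 + t)
  ...     | yes (i₀ , k≡s∸1) = ≤-trans (degreeSum≤-around i₀ k≡s∸1 (trans (s∸1+2≡s+1 t) (sym ∣X∣≡s+1))
                                                                       (≤-trans excess≤ (≤-reflexive (sym (s∸2+3≡s+1 t)))))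
                                       ([s∸1][s∸2]+12≤s[s∸1]+4 (≰⇒> t≰1))
  ...     | no no-edge-of-size-s∸1 = ≤-trans (degreeSum≤-uniform k≤s∸2 excess≤) ([s∸2][s+1]≤s[s∸1]+4 t)
    where
    k≤s∸2 : ∀ i → k i ≤ 1 + t
    k≤s∸2 i = ≤-pred (≤∧≢⇒< (≤-pred (≤∧≢⇒< (k≤s i) (no-edge-of-size-s ∘ (i ,_)))) (no-edge-of-size-s∸1 ∘ (i ,_)))

lemma6 : (s n : ℕ) → 3 ≤ s → (H : Hypergraph n) → Uniform s H →
         ((F : Subset (m H)) → ∣ F ∣ < 2 ^ (s + 1) → (s ∸ 1) * ∣ F ∣ ≤ ∣ unionOf H F ∣) →
         (X : Subset n) → ∣ X ∣ ≡ s + 1 →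
         inducedEdgeCount H X ≤ s C 2 + 2
lemma6 s@(suc (suc (suc t))) n (s≤s (s≤s (s≤s z≤n))) H uniform small-unions X ∣X∣≡s+1 = *-cancelˡ-≤ 2 (begin
  2 * inducedEdgeCount H X        ≤⟨ handshake ⟩
  ∑[ u < n ] (χ u * deg u)        ≤⟨ degreeSum≤s[s∸1]+4 t H uniform X ∣X∣≡s+1 excess≤ ⟩
  s * (s ∸ 1) + 4                 ≡⟨ cong (_+ 4) (2*nC2≡n*[n∸1] s) ⟨
  2 * (s C 2) + 2 * 2             ≡⟨ *-distribˡ-+ 2 (s C 2) 2 ⟨
  2 * (s C 2 + 2)                 ∎)
  where
  open ≤-Reasoning
  open Trace H X
  open Excess s (s≤s z≤n) H uniform small-unions X ∣X∣≡s+1
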